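{- Let $d$ be a positive integer and $T$ a $d$-minimal triangle with $W(T)=\{a,b,c\}$. Then $a+b+c\equiv 1 \pmod d$.
   Context: $\mathcal{L}_d = \frac{1}{d}\mathbb{Z}\times\frac{1}{d}\mathbb{Z}$. A triangle is $d$-minimal if its intersection with $\mathcal{L}_d$ consists exactly of its three vertices. For an oriented segment $E_{p\to q}$ with $p=(w/d,x/d)$, $q=(y/d,z/d)$ ($w,x,y,z\in\mathbb{Z}$), its weight is $W(E_{p\to q}) = wz-xy \bmod d$. For a $d$-minimal triangle $T$ with vertices $p,q,r$ listed so that the counterclockwise orientation of $T$ orients its edges as $p\to q$, $q\to r$, $r\to p$, the weight of $T$ is the multiset $W(T)=\{W(E_{p\to q}), W(E_{q\to r}), W(E_{r\to p})\}$ of residues mod $d$. -}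

module Defs where

open import Data.Nat as ℕ using (ℕ)
open import Data.Integer using (ℤ; +_; _+_; _-_; _*_; _≤_; _<_; _%ℕ_)
open import Data.Product using (_×_; _,_; ∃-syntax; proj₁; proj₂)
open import Data.Sum using (_⊎_)
open import Data.List using (List; _∷_; [])
open import Relation.Binary.PropositionalEquality using (_≡_)

-- A point of 𝓛_d = (1/d)ℤ × (1/d)ℤ is represented by its numerator pair
-- (w , x) ∈ ℤ × ℤ, standing for the point (w/d , x/d).
Pt : Set
Pt = ℤ × ℤ

det : Pt → Pt → ℤ
det (w , x) (y , z) = w * z - x * y

W : (d : ℕ) .{{_ : ℕ.NonZero d}} → Pt → Pt → ℕ
W d p q = det p q %ℕ d

_−ₚ_ : Pt → Pt → Pt
(a , b) −ₚ (c , e) = (a - c , b - e)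

-- Orientation: p, q, r are listed counterclockwise (strictly, so the triangle
-- is non-degenerate).  Scaling by 1/d does not change the sign.
CCW : Pt → Pt → Pt → Set
CCW p q r = + 0 < det (q −ₚ p) (r −ₚ p)

-- u lies in the closed triangle (convex hull) of p, q, r:
-- u = (A p + B q + C r) / D with A, B, C ≥ 0 integers, D = A + B + C > 0,
-- i.e. u is a convex combination with rational coefficients A/D, B/D, C/D.
-- (A lattice point in the real convex hull of lattice points is a
-- convex combination with rational coefficients.)
InTriangle : Pt → Pt → Pt → Pt → Set
InTriangle (p₁ , p₂) (q₁ , q₂) (r₁ , r₂) (u₁ , u₂) =
  ∃[ A ] ∃[ B ] ∃[ C ]
    (+ 0 ≤ A × + 0 ≤ B × + 0 ≤ C × + 0 < A + B + C ×
     (A + B + C) * u₁ ≡ A * p₁ + B * q₁ + C * r₁ ×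
     (A + B + C) * u₂ ≡ A * p₂ + B * q₂ + C * r₂)

-- d-minimal: the (non-degenerate) triangle with vertices p, q, r meets 𝓛_d
-- exactly in its three vertices.  (Vertices lie in 𝓛_d by representation.)
DMinimal : Pt → Pt → Pt → Set
DMinimal p q r = ∀ u → InTriangle p q r u → (u ≡ p ⊎ u ≡ q ⊎ u ≡ r)

WT : (d : ℕ) .{{_ : ℕ.NonZero d}} → Pt → Pt → Pt → List ℕ
WT d p q r = W d p q ∷ W d q r ∷ W d r p ∷ []

-- The weights of the three edges add up to det(p, q) + det(q, r) + det(r, p)
-- = det(q - p, r - p) in numerator coordinates, so it suffices to show that a
-- d-minimal triangle, scaled by d, is a unimodular lattice triangle.
-- Put u = q - p, v = r - p and n = det(u, v) > 0.  By Cramer's rule every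
-- lattice vector y satisfies n y = det(y, v) u + det(u, y) v, and reducing y
-- modulo ℤu + ℤv makes both coefficients residues s, t ∈ [0, n).  If s + t ≤ n,
-- then p + y lies in the triangle with barycentric weights (n - s - t, s, t)/n,
-- so minimality forces s = t = 0; if s + t > n, the same applies to u + v - y,
-- whose residues are n - s and n - t.  Hence n divides every coordinate of u
-- and v, so n² ∣ det(u, v) = n and n = 1.
module Submission where

open import Defs
open import Data.Nat using (ℕ; NonZero; _+_; _%_)
open import Data.List using (_∷_; [])
open import Data.List.Relation.Binary.Permutation.Propositional using (_↭_)
open import Relation.Binary.PropositionalEquality using (_≡_)

open import Data.Nat as ℕ using (suc; _∸_; z≤n)
import Data.Nat.Properties as ℕ
open import Data.Nat.Divisibility using (∣1⇒≡1)
open import Data.Nat.DivMod using ([m+kn]%n≡m%n)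
open import Data.Nat.ListAction using (sum)
open import Data.Nat.ListAction.Properties using (sum-↭)
open import Data.Integer as ℤ using (ℤ; +_; -[1+_]; +[1+_]; 0ℤ; 1ℤ; _%ℕ_; _/ℕ_; +<+; +≤+)
import Data.Integer.Properties as ℤ
open import Data.Integer.DivMod using (a≡a%ℕn+[a/ℕn]*n; n%ℕd<d)
open import Data.Integer.Divisibility.Signed
  using (divides; ∣-trans; *-monoʳ-∣; *-monoˡ-∣; ∣m∣n⇒∣m-n; *-cancelˡ-∣; ∣⇒∣ᵤ)
  renaming (_∣_ to _∣ℤ_)
open import Data.Integer.Tactic.RingSolver using (solve-∀)
open import Data.Product using (_×_; _,_; proj₁; proj₂)
open import Data.Sum using (inj₁; inj₂)
open import Data.Empty using (⊥-elim)
open import Relation.Nullary using (yes; no)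
open import Relation.Binary.PropositionalEquality
  using (refl; sym; trans; cong; cong₂; subst; module ≡-Reasoning)
open ≡-Reasoning

infixl 6 _+ₚ_
infixr 7 _·ₚ_

_+ₚ_ : Pt → Pt → Pt
(a , b) +ₚ (c , e) = (a ℤ.+ c , b ℤ.+ e)

_·ₚ_ : ℤ → Pt → Pt
k ·ₚ (a , b) = (k ℤ.* a , k ℤ.* b)

+ₚ-cancelˡ : ∀ p y {w} → p +ₚ y ≡ w → y ≡ w −ₚ p
+ₚ-cancelˡ (a , b) (y₁ , y₂) refl = cong₂ _,_ (identity a y₁) (identity b y₂)
  where
  identity : ∀ a y → y ≡ (a ℤ.+ y) ℤ.- a
  identity = solve-∀

cramer : ∀ u v y → det u v ·ₚ y ≡ det y v ·ₚ u +ₚ det u y ·ₚ v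
cramer (a , b) (c , e) (y₁ , y₂) = cong₂ _,_ (first a b c e y₁ y₂) (second a b c e y₁ y₂)
  where
  first : ∀ a b c e y₁ y₂ → (a ℤ.* e ℤ.- b ℤ.* c) ℤ.* y₁
    ≡ (y₁ ℤ.* e ℤ.- y₂ ℤ.* c) ℤ.* a ℤ.+ (a ℤ.* y₂ ℤ.- b ℤ.* y₁) ℤ.* c
  first = solve-∀
  second : ∀ a b c e y₁ y₂ → (a ℤ.* e ℤ.- b ℤ.* c) ℤ.* y₂
    ≡ (y₁ ℤ.* e ℤ.- y₂ ℤ.* c) ℤ.* b ℤ.+ (a ℤ.* y₂ ℤ.- b ℤ.* y₁) ℤ.* e
  second = solve-∀

det-−ₚ-selfˡ : ∀ p v → det (p −ₚ p) v ≡ 0ℤ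
det-−ₚ-selfˡ (a , b) (c , e) = identity a b c e
  where
  identity : ∀ a b c e → (a ℤ.- a) ℤ.* e ℤ.- (b ℤ.- b) ℤ.* c ≡ 0ℤ
  identity = solve-∀

det-−ₚ-selfʳ : ∀ u p → det u (p −ₚ p) ≡ 0ℤ
det-−ₚ-selfʳ (a , b) (c , e) = identity a b c e
  where
  identity : ∀ a b c e → a ℤ.* (e ℤ.- e) ℤ.- b ℤ.* (c ℤ.- c) ≡ 0ℤ
  identity = solve-∀

det-reflectˡ : ∀ u v y → det ((u +ₚ v) −ₚ y) v ≡ det u v ℤ.- det y v
det-reflectˡ (a , b) (c , e) (y₁ , y₂) = identity a b c e y₁ y₂
  where
  identity : ∀ a b c e y₁ y₂ → (a ℤ.+ c ℤ.- y₁) ℤ.* e ℤ.- (b ℤ.+ e ℤ.- y₂) ℤ.* c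
    ≡ (a ℤ.* e ℤ.- b ℤ.* c) ℤ.- (y₁ ℤ.* e ℤ.- y₂ ℤ.* c)
  identity = solve-∀

det-reflectʳ : ∀ u v y → det u ((u +ₚ v) −ₚ y) ≡ det u v ℤ.- det u y
det-reflectʳ (a , b) (c , e) (y₁ , y₂) = identity a b c e y₁ y₂
  where
  identity : ∀ a b c e y₁ y₂ → a ℤ.* (b ℤ.+ e ℤ.- y₂) ℤ.- b ℤ.* (a ℤ.+ c ℤ.- y₁)
    ≡ (a ℤ.* e ℤ.- b ℤ.* c) ℤ.- (a ℤ.* y₂ ℤ.- b ℤ.* y₁)
  identity = solve-∀

det-reduceˡ : ∀ x u v k l → det (x −ₚ (k ·ₚ u +ₚ l ·ₚ v)) v ≡ det x v ℤ.- k ℤ.* det u v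
det-reduceˡ (x₁ , x₂) (a , b) (c , e) k l = identity a b c e x₁ x₂ k l
  where
  identity : ∀ a b c e x₁ x₂ k l →
    (x₁ ℤ.- (k ℤ.* a ℤ.+ l ℤ.* c)) ℤ.* e ℤ.- (x₂ ℤ.- (k ℤ.* b ℤ.+ l ℤ.* e)) ℤ.* c
      ≡ (x₁ ℤ.* e ℤ.- x₂ ℤ.* c) ℤ.- k ℤ.* (a ℤ.* e ℤ.- b ℤ.* c)
  identity = solve-∀

det-reduceʳ : ∀ x u v k l → det u (x −ₚ (k ·ₚ u +ₚ l ·ₚ v)) ≡ det u x ℤ.- l ℤ.* det u v
det-reduceʳ (x₁ , x₂) (a , b) (c , e) k l = identity a b c e x₁ x₂ k l
  where
  identity : ∀ a b c e x₁ x₂ k l →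
    a ℤ.* (x₂ ℤ.- (k ℤ.* b ℤ.+ l ℤ.* e)) ℤ.- b ℤ.* (x₁ ℤ.- (k ℤ.* a ℤ.+ l ℤ.* c))
      ≡ (a ℤ.* x₂ ℤ.- b ℤ.* x₁) ℤ.- l ℤ.* (a ℤ.* e ℤ.- b ℤ.* c)
  identity = solve-∀

det-basis : ∀ u v →
  det u v ≡ det u (0ℤ , 1ℤ) ℤ.* det (1ℤ , 0ℤ) v ℤ.- det u (1ℤ , 0ℤ) ℤ.* det (0ℤ , 1ℤ) v
det-basis (a , b) (c , e) = identity a b c e
  where
  identity : ∀ a b c e → a ℤ.* e ℤ.- b ℤ.* c
    ≡ (a ℤ.* 1ℤ ℤ.- b ℤ.* 0ℤ) ℤ.* (1ℤ ℤ.* e ℤ.- 0ℤ ℤ.* c)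
      ℤ.- (a ℤ.* 0ℤ ℤ.- b ℤ.* 1ℤ) ℤ.* (0ℤ ℤ.* e ℤ.- 1ℤ ℤ.* c)
  identity = solve-∀

det-cyclic-sum : ∀ p q r → det p q ℤ.+ det q r ℤ.+ det r p ≡ det (q −ₚ p) (r −ₚ p)
det-cyclic-sum (p₁ , p₂) (q₁ , q₂) (r₁ , r₂) = identity p₁ p₂ q₁ q₂ r₁ r₂
  where
  identity : ∀ p₁ p₂ q₁ q₂ r₁ r₂ →
    (p₁ ℤ.* q₂ ℤ.- p₂ ℤ.* q₁) ℤ.+ (q₁ ℤ.* r₂ ℤ.- q₂ ℤ.* r₁) ℤ.+ (r₁ ℤ.* p₂ ℤ.- r₂ ℤ.* p₁)
      ≡ (q₁ ℤ.- p₁) ℤ.* (r₂ ℤ.- p₂) ℤ.- (q₂ ℤ.- p₂) ℤ.* (r₁ ℤ.- p₁)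
  identity = solve-∀

InTriangle-offset : ∀ p q r y {n s t : ℕ} → 0 ℕ.< n → s + t ℕ.≤ n →
  + n ·ₚ y ≡ + s ·ₚ (q −ₚ p) +ₚ + t ·ₚ (r −ₚ p) → InTriangle p q r (p +ₚ y)
InTriangle-offset (p₁ , p₂) (q₁ , q₂) (r₁ , r₂) (y₁ , y₂) {n} {s} {t} 0<n s+t≤n ny≡ =
  + A , + s , + t , +≤+ z≤n , +≤+ z≤n , +≤+ z≤n , +<+ (subst (0 ℕ.<_) (sym total) 0<n) ,
  coordinate p₁ q₁ r₁ y₁ (cong proj₁ ny≡) , coordinate p₂ q₂ r₂ y₂ (cong proj₂ ny≡)
  where
  A : ℕ
  A = n ∸ (s + t)

  total : A + s + t ≡ n
  total = trans (ℕ.+-assoc A s t) (ℕ.m∸n+n≡m s+t≤n)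

  regroup : ∀ A S T a b c → (A ℤ.+ S ℤ.+ T) ℤ.* a ℤ.+ (S ℤ.* (b ℤ.- a) ℤ.+ T ℤ.* (c ℤ.- a))
    ≡ A ℤ.* a ℤ.+ S ℤ.* b ℤ.+ T ℤ.* c
  regroup = solve-∀

  coordinate : ∀ a b c z → + n ℤ.* z ≡ + s ℤ.* (b ℤ.- a) ℤ.+ + t ℤ.* (c ℤ.- a) →
    (+ A ℤ.+ + s ℤ.+ + t) ℤ.* (a ℤ.+ z) ≡ + A ℤ.* a ℤ.+ + s ℤ.* b ℤ.+ + t ℤ.* c
  coordinate a b c z nz≡ = begin
    + (A + s + t) ℤ.* (a ℤ.+ z)                    ≡⟨ cong (λ m → + m ℤ.* (a ℤ.+ z)) total ⟩
    + n ℤ.* (a ℤ.+ z)                              ≡⟨ ℤ.*-distribˡ-+ (+ n) a z ⟩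
    + n ℤ.* a ℤ.+ + n ℤ.* z                        ≡⟨ cong (λ m → + n ℤ.* a ℤ.+ m) nz≡ ⟩
    + n ℤ.* a ℤ.+ (+ s ℤ.* (b ℤ.- a) ℤ.+ + t ℤ.* (c ℤ.- a))
      ≡⟨ cong (λ m → + m ℤ.* a ℤ.+ (+ s ℤ.* (b ℤ.- a) ℤ.+ + t ℤ.* (c ℤ.- a))) total ⟨
    + (A + s + t) ℤ.* a ℤ.+ (+ s ℤ.* (b ℤ.- a) ℤ.+ + t ℤ.* (c ℤ.- a))
      ≡⟨ regroup (+ A) (+ s) (+ t) a b c ⟩
    + A ℤ.* a ℤ.+ + s ℤ.* b ℤ.+ + t ℤ.* c          ∎

+m-+n≡+[m∸n] : ∀ {m n} → n ℕ.≤ m → + m ℤ.- + n ≡ + (m ∸ n)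
+m-+n≡+[m∸n] {m} {n} n≤m = trans (ℤ.m-n≡m⊖n m n) (ℤ.⊖-≥ n≤m)

module _ {d : ℕ} .{{_ : NonZero d}} where

  a-[a/ℕn]*n≡a%ℕn : ∀ i → i ℤ.- i /ℕ d ℤ.* + d ≡ + (i %ℕ d)
  a-[a/ℕn]*n≡a%ℕn i = begin
    i ℤ.- q ℤ.* + d                         ≡⟨ cong (ℤ._- q ℤ.* + d) (a≡a%ℕn+[a/ℕn]*n i d) ⟩
    (+ (i %ℕ d) ℤ.+ q ℤ.* + d) ℤ.- q ℤ.* + d ≡⟨ cancel (+ (i %ℕ d)) (q ℤ.* + d) ⟩
    + (i %ℕ d)                              ∎
    where
    q = i /ℕ d
    cancel : ∀ a b → (a ℤ.+ b) ℤ.- b ≡ a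
    cancel = solve-∀

  %ℕ≡0⇒∣ : ∀ i → i %ℕ d ≡ 0 → + d ∣ℤ i
  %ℕ≡0⇒∣ i i%d≡0 = divides (i /ℕ d) (begin
    i                                ≡⟨ a≡a%ℕn+[a/ℕn]*n i d ⟩
    + (i %ℕ d) ℤ.+ i /ℕ d ℤ.* + d    ≡⟨ cong (λ m → + m ℤ.+ i /ℕ d ℤ.* + d) i%d≡0 ⟩
    0ℤ ℤ.+ i /ℕ d ℤ.* + d            ≡⟨ ℤ.+-identityˡ _ ⟩
    i /ℕ d ℤ.* + d                   ∎)

  m≡n+k*d⇒m%d≡n%d : ∀ m n k → + m ≡ + n ℤ.+ k ℤ.* + d → m % d ≡ n % d
  m≡n+k*d⇒m%d≡n%d m n (+ k) m≡n+kd = begin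
    m % d           ≡⟨ cong (_% d) (ℤ.+-injective (trans m≡n+kd (cong (λ m → + n ℤ.+ m) (sym (ℤ.pos-* k d))))) ⟩
    (n + k ℕ.* d) % d ≡⟨ [m+kn]%n≡m%n n k d ⟩
    n % d           ∎
  m≡n+k*d⇒m%d≡n%d m n -[1+ k ] m≡n+kd =
    sym (m≡n+k*d⇒m%d≡n%d n m (+ suc k) (swap (+ m) (+ n) -[1+ k ] (+ d) m≡n+kd))
    where
    swap : ∀ a b K D → a ≡ b ℤ.+ K ℤ.* D → b ≡ a ℤ.+ ℤ.- K ℤ.* D
    swap .(b ℤ.+ K ℤ.* D) b K D refl = identity b K D
      where
      identity : ∀ b K D → b ≡ (b ℤ.+ K ℤ.* D) ℤ.+ ℤ.- K ℤ.* D
      identity = solve-∀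

  residue-sum : ∀ i j k m → i ℤ.+ j ℤ.+ k ≡ + m → (i %ℕ d + j %ℕ d + k %ℕ d) % d ≡ m % d
  residue-sum i j k m sum≡m = m≡n+k*d⇒m%d≡n%d _ m K (begin
    + (i %ℕ d) ℤ.+ + (j %ℕ d) ℤ.+ + (k %ℕ d)
      ≡⟨ cong₂ ℤ._+_ (cong₂ ℤ._+_ (residue i) (residue j)) (residue k) ⟨
    (i ℤ.- qi ℤ.* + d) ℤ.+ (j ℤ.- qj ℤ.* + d) ℤ.+ (k ℤ.- qk ℤ.* + d)
      ≡⟨ regroup i j k qi qj qk (+ d) ⟩
    i ℤ.+ j ℤ.+ k ℤ.+ K ℤ.* + d
      ≡⟨ cong (ℤ._+ K ℤ.* + d) sum≡m ⟩
    + m ℤ.+ K ℤ.* + d ∎)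
    where
    residue = a-[a/ℕn]*n≡a%ℕn
    qi = i /ℕ d
    qj = j /ℕ d
    qk = k /ℕ d
    K = ℤ.- (qi ℤ.+ qj ℤ.+ qk)
    regroup : ∀ i j k qi qj qk D →
      (i ℤ.- qi ℤ.* D) ℤ.+ (j ℤ.- qj ℤ.* D) ℤ.+ (k ℤ.- qk ℤ.* D)
        ≡ i ℤ.+ j ℤ.+ k ℤ.+ ℤ.- (qi ℤ.+ qj ℤ.+ qk) ℤ.* D
    regroup = solve-∀

*-pres-∣ : ∀ {k i j} → k ∣ℤ i → k ∣ℤ j → k ℤ.* k ∣ℤ i ℤ.* j
*-pres-∣ {k} {j = j} k∣i k∣j = ∣-trans (*-monoʳ-∣ k k∣j) (*-monoˡ-∣ j k∣i)

module MinimalTriangle (p q r : Pt) (minimal : DMinimal p q r)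
  (n : ℕ) .{{_ : NonZero n}} (det≡n : det (q −ₚ p) (r −ₚ p) ≡ + n) where

  u v : Pt
  u = q −ₚ p
  v = r −ₚ p

  scaled-offset : ∀ y {s t} → det y v ≡ + s → det u y ≡ + t → + n ·ₚ y ≡ + s ·ₚ u +ₚ + t ·ₚ v
  scaled-offset y {s} {t} hs ht = begin
    + n ·ₚ y                          ≡⟨ cong (_·ₚ y) det≡n ⟨
    det u v ·ₚ y                      ≡⟨ cramer u v y ⟩
    det y v ·ₚ u +ₚ det u y ·ₚ v      ≡⟨ cong₂ (λ a b → a ·ₚ u +ₚ b ·ₚ v) hs ht ⟩
    + s ·ₚ u +ₚ + t ·ₚ v              ∎

  small-residues-vanish : ∀ y {s t} → det y v ≡ + s → det u y ≡ + t →
    s ℕ.< n → t ℕ.< n → s + t ℕ.≤ n → s + t ≡ 0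
  small-residues-vanish y {s} {t} hs ht s<n t<n s+t≤n
    with minimal (p +ₚ y) (InTriangle-offset p q r y {n} {s} {t} (ℕ.>-nonZero⁻¹ n) s+t≤n (scaled-offset y hs ht))
  ... | inj₁ at-p = cong₂ _+_ (ℤ.+-injective s≡0) (ℤ.+-injective t≡0)
    where
    y≡0 = +ₚ-cancelˡ p y at-p
    s≡0 = trans (sym hs) (trans (cong (λ z → det z v) y≡0) (det-−ₚ-selfˡ p v))
    t≡0 = trans (sym ht) (trans (cong (det u) y≡0) (det-−ₚ-selfʳ u p))
  ... | inj₂ (inj₁ at-q) = ⊥-elim (ℕ.<⇒≢ s<n (ℤ.+-injective s≡n))
    where
    s≡n = trans (sym hs) (trans (cong (λ z → det z v) (+ₚ-cancelˡ p y at-q)) det≡n)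
  ... | inj₂ (inj₂ at-r) = ⊥-elim (ℕ.<⇒≢ t<n (ℤ.+-injective t≡n))
    where
    t≡n = trans (sym ht) (trans (cong (det u) (+ₚ-cancelˡ p y at-r)) det≡n)

  residues-vanish : ∀ y {s t} → det y v ≡ + s → det u y ≡ + t →
    s ℕ.< n → t ℕ.< n → s ≡ 0 × t ≡ 0
  residues-vanish y {s} {t} hs ht s<n t<n with s + t ℕ.≤? n
  ... | yes s+t≤n = ℕ.m+n≡0⇒m≡0 s s+t≡0 , ℕ.m+n≡0⇒n≡0 s s+t≡0
    where s+t≡0 = small-residues-vanish y hs ht s<n t<n s+t≤n
  ... | no s+t≰n = ⊥-elim (ℕ.<⇒≱ s<n (ℕ.m∸n≡0⇒m≤n (ℕ.m+n≡0⇒m≡0 (n ∸ s) reflected)))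
    where
    n<s+t = ℕ.≰⇒> s+t≰n
    n∸t≤s : n ∸ t ℕ.≤ s
    n∸t≤s = ℕ.m≤n+o⇒m∸n≤o n t (ℕ.<⇒≤ (subst (n ℕ.<_) (ℕ.+-comm s t) n<s+t))
    n∸s≤t : n ∸ s ℕ.≤ t
    n∸s≤t = ℕ.m≤n+o⇒m∸n≤o n s (ℕ.<⇒≤ n<s+t)
    n∸s<n : n ∸ s ℕ.< n
    n∸s<n = ℕ.∸-monoʳ-< (ℕ.<-≤-trans (ℕ.m<n⇒0<n∸m t<n) n∸t≤s) (ℕ.<⇒≤ s<n)
    n∸t<n : n ∸ t ℕ.< n
    n∸t<n = ℕ.∸-monoʳ-< (ℕ.<-≤-trans (ℕ.m<n⇒0<n∸m s<n) n∸s≤t) (ℕ.<⇒≤ t<n)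
    sum≤n : (n ∸ s) + (n ∸ t) ℕ.≤ n
    sum≤n = ℕ.≤-trans (ℕ.+-monoʳ-≤ (n ∸ s) n∸t≤s) (ℕ.≤-reflexive (ℕ.m∸n+n≡m (ℕ.<⇒≤ s<n)))
    w = (u +ₚ v) −ₚ y
    hs′ : det w v ≡ + (n ∸ s)
    hs′ = trans (det-reflectˡ u v y) (trans (cong₂ ℤ._-_ det≡n hs) (+m-+n≡+[m∸n] (ℕ.<⇒≤ s<n)))
    ht′ : det u w ≡ + (n ∸ t)
    ht′ = trans (det-reflectʳ u v y) (trans (cong₂ ℤ._-_ det≡n ht) (+m-+n≡+[m∸n] (ℕ.<⇒≤ t<n)))
    reflected : (n ∸ s) + (n ∸ t) ≡ 0
    reflected = small-residues-vanish w hs′ ht′ n∸s<n n∸t<n sum≤n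

  n∣det : ∀ x → + n ∣ℤ det x v × + n ∣ℤ det u x
  n∣det x = %ℕ≡0⇒∣ (det x v) (proj₁ vanish) , %ℕ≡0⇒∣ (det u x) (proj₂ vanish)
    where
    y = x −ₚ ((det x v /ℕ n) ·ₚ u +ₚ (det u x /ℕ n) ·ₚ v)
    hs : det y v ≡ + (det x v %ℕ n)
    hs = begin
      det y v                                    ≡⟨ det-reduceˡ x u v (det x v /ℕ n) (det u x /ℕ n) ⟩
      det x v ℤ.- det x v /ℕ n ℤ.* det u v       ≡⟨ cong (λ m → det x v ℤ.- det x v /ℕ n ℤ.* m) det≡n ⟩
      det x v ℤ.- det x v /ℕ n ℤ.* + n           ≡⟨ a-[a/ℕn]*n≡a%ℕn (det x v) ⟩
      + (det x v %ℕ n)                           ∎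
    ht : det u y ≡ + (det u x %ℕ n)
    ht = begin
      det u y                                    ≡⟨ det-reduceʳ x u v (det x v /ℕ n) (det u x /ℕ n) ⟩
      det u x ℤ.- det u x /ℕ n ℤ.* det u v       ≡⟨ cong (λ m → det u x ℤ.- det u x /ℕ n ℤ.* m) det≡n ⟩
      det u x ℤ.- det u x /ℕ n ℤ.* + n           ≡⟨ a-[a/ℕn]*n≡a%ℕn (det u x) ⟩
      + (det u x %ℕ n)                           ∎
    vanish = residues-vanish y hs ht (n%ℕd<d (det x v) n) (n%ℕd<d (det u x) n)

  n≡1 : n ≡ 1
  n≡1 = ∣1⇒≡1 (∣⇒∣ᵤ (*-cancelˡ-∣ (+ n) n²∣n))
    where
    e₁ e₂ : Pt
    e₁ = (1ℤ , 0ℤ)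
    e₂ = (0ℤ , 1ℤ)
    n²∣n : + n ℤ.* + n ∣ℤ + n ℤ.* 1ℤ
    n²∣n = subst (+ n ℤ.* + n ∣ℤ_)
      (trans (sym (det-basis u v)) (trans det≡n (sym (ℤ.*-identityʳ (+ n)))))
      (∣m∣n⇒∣m-n (*-pres-∣ (proj₂ (n∣det e₂)) (proj₁ (n∣det e₁)))
                 (*-pres-∣ (proj₂ (n∣det e₁)) (proj₁ (n∣det e₂))))

minimal⇒unimodular : ∀ p q r → CCW p q r → DMinimal p q r → det (q −ₚ p) (r −ₚ p) ≡ 1ℤ
minimal⇒unimodular p q r ccw minimal with det (q −ₚ p) (r −ₚ p) in det≡ | ccw
... | +[1+ m ] | _ = cong +_ (MinimalTriangle.n≡1 p q r minimal (suc m) det≡)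
... | + 0 | +<+ ()

sum-triple : ∀ a b c → sum (a ∷ b ∷ c ∷ []) ≡ a + b + c
sum-triple a b c = trans (cong (λ m → a + (b + m)) (ℕ.+-identityʳ c)) (sym (ℕ.+-assoc a b c))

mainTheorem6 : (d : ℕ) → .{{_ : NonZero d}} → (p q r : Pt) →
    CCW p q r → DMinimal p q r →
    (a b c : ℕ) → WT d p q r ↭ (a ∷ b ∷ c ∷ []) →
    (a + b + c) % d ≡ 1 % d
mainTheorem6 d p q r ccw minimal a b c weights↭ = begin
  (a + b + c) % d                        ≡⟨ cong (_% d) same-sum ⟨
  (W d p q + W d q r + W d r p) % d      ≡⟨ residue-sum (det p q) (det q r) (det r p) 1 unimodular ⟩
  1 % d                                  ∎
  where
  same-sum : W d p q + W d q r + W d r p ≡ a + b + c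
  same-sum = trans (sym (sum-triple (W d p q) (W d q r) (W d r p))) (trans (sum-↭ weights↭) (sum-triple a b c))
  unimodular : det p q ℤ.+ det q r ℤ.+ det r p ≡ 1ℤ
  unimodular = trans (det-cyclic-sum p q r) (minimal⇒unimodular p q r ccw minimal)
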